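{- Let $\mathcal X'=(\Omega',\{R'_i\}_{i=0}^7)$ be an association scheme algebraically isomorphic to the flag scheme $\mathcal X=(\Omega,\{R_i\}_{i=0}^7)$ of a generalized quadrangle of order $(s,t)$, via an algebraic isomorphism $\phi$ with $R'_i=\phi(R_i)$. Call the classes of the equivalence relation $R'_0\cup R'_1$ point-cliques and those of $R'_0\cup R'_2$ line-cliques; a point-clique $C_1$ and a line-clique $C_2$ are incident if $C_1\cap C_2\ne\emptyset$. If $C_1$ is a point-clique and $C_2$ a line-clique that are not incident, then there is at most one pair $(x,y)\in C_1\times C_2$ with $(x,y)\in R'_3$.
   Context: A finite generalized quadrangle of order $(s,t)$ is an incidence structure of points and lines in which each point is on $t+1$ lines, each line has $s+1$ points, two distinct points lie on at most one common line, two distinct lines share at most one point, and for every non-incident point $p$ and line $L$ there is a unique pair $(q,M)$ with $p\,\mathrm I\,M\,\mathrm I\,q\,\mathrm I\,L$. Its flag scheme $\mathcal X$: $\Omega$ is the set of incident pairs $(p,L)$, $R_0$ the diagonal, and for flags $(p,L),(q,M)$: $R_1$: $p=q$, $L\ne M$; $R_2$: $L=M$, $p\ne q$; $R_3$: $p\ne q$ collinear on $L$, $M\ne L$; $R_4$: $p\neq q$ collinear on $M$, $L\neq M$; $R_5$: $p\ne q$ collinear on a line different from $L$ and $M$; $R_6$: $L\ne M$ meet in a point $r\ne p,q$; $R_7$: $L,M$ disjoint and $p,q$ not collinear. This is an association scheme with intersection numbers $p^k_{ij}$. An algebraic isomorphism from $\mathcal X$ to an association scheme $\mathcal X'$ is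 a bijection $\phi$ between their sets of basis relations such that $p'^{\phi(R_k)}_{\phi(R_i)\phi(R_j)}=p^k_{ij}$ for all $i,j,k$. -}

module Defs where

open import Data.Nat using (ℕ; zero; suc; _+_)
open import Data.Fin using (Fin; #_) renaming (zero to fz; suc to fs)
open import Data.Fin.Properties using (_≟_)
open import Data.Bool using (Bool; true; false; _∧_; _∨_; not; if_then_else_)
open import Data.Product using (Σ; ∃; ∃-syntax; _×_; _,_)
open import Data.Sum using (_⊎_)
open import Relation.Nullary using (¬_)
open import Relation.Nullary.Decidable using (⌊_⌋)
open import Relation.Binary.PropositionalEquality using (_≡_; _≢_)
open import Function.Bundles using (_↔_; Inverse)

sumFin : ∀ {n} → (Fin n → ℕ) → ℕ
sumFin {zero}  f = 0
sumFin {suc n} f = f fz + sumFin (λ x → f (fs x))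

countFin : ∀ {n} → (Fin n → Bool) → ℕ
countFin P = sumFin (λ x → if P x then 1 else 0)

anyFin : ∀ {n} → (Fin n → Bool) → Bool
anyFin {zero}  P = false
anyFin {suc n} P = P fz ∨ anyFin (λ x → P (fs x))

_==_ : ∀ {n} → Fin n → Fin n → Bool
x == y = ⌊ x ≟ y ⌋

_=/=_ : ∀ {n} → Fin n → Fin n → Bool
x =/= y = not (x == y)

record IsGQ {np nl : ℕ} (s t : ℕ) (I : Fin np → Fin nl → Bool) : Set where
  field
    pointDeg : ∀ p → countFin (λ L → I p L) ≡ suc t
    lineDeg  : ∀ L → countFin (λ p → I p L) ≡ suc s
    pointsOneLine : ∀ p q L M → p ≢ q →
      I p L ≡ true → I q L ≡ true → I p M ≡ true → I q M ≡ true → L ≡ M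
    linesOnePoint : ∀ L M p q → L ≢ M →
      I p L ≡ true → I p M ≡ true → I q L ≡ true → I q M ≡ true → p ≡ q
    gqAxiom : ∀ p L → I p L ≡ false →
      Σ (Fin np × Fin nl) λ { (q , M) →
        (I p M ≡ true × I q M ≡ true × I q L ≡ true) ×
        (∀ q' M' → I p M' ≡ true → I q' M' ≡ true → I q' L ≡ true →
           q' ≡ q × M' ≡ M) }

-- The eight relations of the flag scheme, as boolean predicates on
-- pairs of flags (p,L), (q,M) (incidence of the flags is assumed
-- separately).  Written literally as in the definition.

flagRel : ∀ {np nl} → (Fin np → Fin nl → Bool) → Fin 8 →
          Fin np → Fin nl → Fin np → Fin nl → Bool
flagRel I fz p L q M = (p == q) ∧ (L == M)
flagRel I (fs fz) p L q M = (p == q) ∧ (L =/= M)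
flagRel I (fs (fs fz)) p L q M = (L == M) ∧ (p =/= q)
flagRel I (fs (fs (fs fz))) p L q M = (p =/= q) ∧ I p L ∧ I q L ∧ (M =/= L)
flagRel I (fs (fs (fs (fs fz)))) p L q M = (p =/= q) ∧ I p M ∧ I q M ∧ (L =/= M)
flagRel I (fs (fs (fs (fs (fs fz))))) p L q M =
  (p =/= q) ∧ anyFin (λ N → I p N ∧ I q N ∧ (N =/= L) ∧ (N =/= M))
flagRel I (fs (fs (fs (fs (fs (fs fz)))))) p L q M =
  (L =/= M) ∧ anyFin (λ r → I r L ∧ I r M ∧ (r =/= p) ∧ (r =/= q))
flagRel I (fs (fs (fs (fs (fs (fs (fs fz))))))) p L q M =
  not (anyFin (λ r → I r L ∧ I r M)) ∧ not (anyFin (λ N → I p N ∧ I q N))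

flagCount : ∀ {np nl} → (Fin np → Fin nl → Bool) → Fin 8 → Fin 8 →
            Fin np → Fin nl → Fin np → Fin nl → ℕ
flagCount I i j p L q M =
  sumFin (λ r → countFin (λ N → I r N ∧ flagRel I i p L r N ∧ flagRel I j r N q M))

-- The flag structure has all eight classes nonempty (this is part of
-- "the flag scheme is an association scheme with classes R_0..R_7").
FlagClassesNonempty : ∀ {np nl} → (Fin np → Fin nl → Bool) → Set
FlagClassesNonempty {np} {nl} I = ∀ (k : Fin 8) →
  Σ (Fin np × Fin nl × Fin np × Fin nl) λ { (p , L , q , M) →
    I p L ≡ true × I q M ≡ true × flagRel I k p L q M ≡ true }

-- Association schemes with 8 basis relations R'_0..R'_7 on Fin n.
-- The relation is given as a colouring R' : Fin n → Fin n → Fin 8,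
-- (x,y) ∈ R'_i  iff  R' x y ≡ i  (so the R'_i partition Ω × Ω).

schemeCount : ∀ {n} → (Fin n → Fin n → Fin 8) → Fin 8 → Fin 8 → Fin n → Fin n → ℕ
schemeCount R i j x y = countFin (λ z → (R x z == i) ∧ (R z y == j))

record IsAssocScheme {n : ℕ} (R : Fin n → Fin n → Fin 8) : Set where
  field
    diag₁ : ∀ x y → R x y ≡ fz → x ≡ y
    diag₂ : ∀ x → R x x ≡ fz
    nonempty : ∀ i → ∃[ x ] ∃[ y ] (R x y ≡ i)
    transpose : ∀ i → ∃[ j ] (∀ x y → R x y ≡ i → R y x ≡ j)
    regular : ∀ i j k x y x' y' → R x y ≡ k → R x' y' ≡ k →
      schemeCount R i j x y ≡ schemeCount R i j x' y'

AlgIso : ∀ {np nl n} → (Fin np → Fin nl → Bool) → (Fin n → Fin n → Fin 8) →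
         (Fin 8 ↔ Fin 8) → Set
AlgIso I R φ = ∀ i j k p L q M → I p L ≡ true → I q M ≡ true →
  flagRel I k p L q M ≡ true →
  ∀ x y → R x y ≡ to k →
  schemeCount R (to i) (to j) x y ≡ flagCount I i j p L q M
  where open Inverse φ

InPointClique : ∀ {n} → (Fin n → Fin n → Fin 8) → (Fin 8 ↔ Fin 8) → Fin n → Fin n → Set
InPointClique R φ a x = R a x ≡ Inverse.to φ (# 0) ⊎ R a x ≡ Inverse.to φ (# 1)

InLineClique : ∀ {n} → (Fin n → Fin n → Fin 8) → (Fin 8 ↔ Fin 8) → Fin n → Fin n → Set
InLineClique R φ b y = R b y ≡ Inverse.to φ (# 0) ⊎ R b y ≡ Inverse.to φ (# 2)

{-# OPTIONS --safe #-}
module Submission where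

open import Defs
open import Data.Nat using (ℕ; zero; suc; _+_)
open import Data.Nat.Properties using (m+n≡0⇒n≡0) renaming (_≟_ to _≟ℕ_)
open import Data.Fin using (Fin; #_) renaming (zero to fz; suc to fs)
open import Data.Bool using (Bool; true; false; _∧_; not; if_then_else_)
open import Data.Bool.Properties using (∨-zeroʳ; T-≡)
open import Data.Product using (Σ-syntax; ∃-syntax; _×_; _,_; proj₁; proj₂)
import Data.Product as Product
open import Data.Sum using (_⊎_; inj₁; inj₂)
open import Data.Empty using (⊥-elim)
open import Function using (_∘_)
open import Function.Bundles using (_↔_; Inverse; Equivalence)
open import Relation.Nullary using (¬_; yes; no; contradiction)
open import Relation.Nullary.Decidable using (toWitness; toWitnessFalse; fromWitness)
open import Relation.Binary.PropositionalEquality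
  using (_≡_; _≢_; refl; sym; trans; cong; cong₂; subst; module ≡-Reasoning)

-- An algebraic isomorphism preserves which intersection numbers vanish, so
-- elements x, y, z of Ω' with (x,y) ∈ φ(R_k), (x,z) ∈ φ(R_i), (z,y) ∈ φ(R_j)
-- force a triangle of flags with relations R_k, R_i, R_j in the quadrangle.
-- Pulling triangles back shows that φ(R_0) is the diagonal and that any two
-- members of a point-clique (line-clique) are in φ(R_0 ∪ R_1) (φ(R_0 ∪ R_2)).
-- For φ(R_3)-pairs (x,y), (x',y') with x ≠ x' or y ≠ y' the geometry then
-- excludes each case: p^3_{32} = p^3_{13} = 0, and if both x ≠ x' and y ≠ y',
-- p^k_{32} ≠ 0 only for k = 6 puts (x,y') in φ(R_6), while p^6_{13} = 0.

∧-true : ∀ a {b} → a ∧ b ≡ true → a ≡ true × b ≡ true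
∧-true true h = refl , h

∧₄-true : ∀ a b c {d} → a ∧ b ∧ c ∧ d ≡ true →
          a ≡ true × b ≡ true × c ≡ true × d ≡ true
∧₄-true true true true h = refl , refl , refl , h

∧-intro : ∀ {a b} → a ≡ true → b ≡ true → a ∧ b ≡ true
∧-intro refl refl = refl

module _ {n : ℕ} {a b : Fin n} where

  ==⇒≡ : (a == b) ≡ true → a ≡ b
  ==⇒≡ = toWitness ∘ Equivalence.from T-≡

  ≡⇒== : a ≡ b → (a == b) ≡ true
  ≡⇒== = Equivalence.to T-≡ ∘ fromWitness

  =/=⇒≢ : (a =/= b) ≡ true → a ≢ b
  =/=⇒≢ = toWitnessFalse ∘ Equivalence.from T-≡

anyFin-intro : ∀ {n} (P : Fin n → Bool) z → P z ≡ true → anyFin P ≡ true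
anyFin-intro P fz Pz rewrite Pz = refl
anyFin-intro P (fs z) Pz rewrite anyFin-intro (λ x → P (fs x)) z Pz = ∨-zeroʳ (P fz)

anyFin⇒∃ : ∀ {n} (P : Fin n → Bool) → anyFin P ≡ true → ∃[ z ] (P z ≡ true)
anyFin⇒∃ {suc n} P any with P fz in Pfz
... | true  = fz , Pfz
... | false = let z , Pz = anyFin⇒∃ (λ x → P (fs x)) any in fs z , Pz

not-anyFin : ∀ {n} (P : Fin n → Bool) z → not (anyFin P) ≡ true → P z ≢ true
not-anyFin P z none Pz with () ← trans (cong not (sym (anyFin-intro P z Pz))) none

sumFin≢0⇒∃ : ∀ {n} (f : Fin n → ℕ) → sumFin f ≢ 0 → ∃[ x ] (f x ≢ 0)
sumFin≢0⇒∃ {zero} f sum≢0 = contradiction refl sum≢0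
sumFin≢0⇒∃ {suc n} f sum≢0 with f fz ≟ℕ 0
... | no f₀≢0 = fz , f₀≢0
... | yes f₀≡0 =
  let x , fx≢0 = sumFin≢0⇒∃ (λ x → f (fs x)) (sum≢0 ∘ cong₂ _+_ f₀≡0) in fs x , fx≢0

countFin≢0⇒∃ : ∀ {n} (P : Fin n → Bool) → countFin P ≢ 0 → ∃[ z ] (P z ≡ true)
countFin≢0⇒∃ {zero} P count≢0 = contradiction refl count≢0
countFin≢0⇒∃ {suc n} P count≢0 with P fz in Pfz
... | true  = fz , Pfz
... | false = let z , Pz = countFin≢0⇒∃ (λ x → P (fs x)) count≢0 in fs z , Pz

∃⇒countFin≢0 : ∀ {n} (P : Fin n → Bool) z → P z ≡ true → countFin P ≢ 0
∃⇒countFin≢0 P fz Pz rewrite Pz = λ ()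
∃⇒countFin≢0 P (fs z) Pz =
  ∃⇒countFin≢0 (λ x → P (fs x)) z Pz ∘ m+n≡0⇒n≡0 (if P fz then 1 else 0)

PointClass : Fin 8 → Set
PointClass i = i ≡ # 0 ⊎ i ≡ # 1

LineClass : Fin 8 → Set
LineClass i = i ≡ # 0 ⊎ i ≡ # 2

PointClass∩LineClass⇒0 : ∀ {i} → PointClass i → LineClass i → i ≡ # 0
PointClass∩LineClass⇒0 (inj₁ i≡0) _ = i≡0
PointClass∩LineClass⇒0 (inj₂ refl) (inj₁ ())
PointClass∩LineClass⇒0 (inj₂ refl) (inj₂ ())

module QuadrangleFlags {np nl s t : ℕ} {I : Fin np → Fin nl → Bool} (gq : IsGQ s t I) where
  open IsGQ gq

  F : Fin 8 → Fin np → Fin nl → Fin np → Fin nl → Bool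
  F = flagRel I

  module _ (p : Fin np) (L : Fin nl) (q : Fin np) (M : Fin nl) where

    R₀-inv : F (# 0) p L q M ≡ true → p ≡ q × L ≡ M
    R₀-inv = Product.map ==⇒≡ ==⇒≡ ∘ ∧-true (p == q)

    R₁-inv : F (# 1) p L q M ≡ true → p ≡ q × L ≢ M
    R₁-inv = Product.map ==⇒≡ =/=⇒≢ ∘ ∧-true (p == q)

    R₂-inv : F (# 2) p L q M ≡ true → L ≡ M × p ≢ q
    R₂-inv = Product.map ==⇒≡ =/=⇒≢ ∘ ∧-true (L == M)

    R₃-inv : F (# 3) p L q M ≡ true → p ≢ q × I p L ≡ true × I q L ≡ true × M ≢ L
    R₃-inv h =
      let p≢q , pL , qL , M≢L = ∧₄-true (p =/= q) (I p L) (I q L) h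
      in =/=⇒≢ p≢q , pL , qL , =/=⇒≢ M≢L

    R₄-inv : F (# 4) p L q M ≡ true → p ≢ q × I p M ≡ true × I q M ≡ true × L ≢ M
    R₄-inv h =
      let p≢q , pM , qM , L≢M = ∧₄-true (p =/= q) (I p M) (I q M) h
      in =/=⇒≢ p≢q , pM , qM , =/=⇒≢ L≢M

    R₅-inv : F (# 5) p L q M ≡ true →
             p ≢ q × ∃[ N ] (I p N ≡ true × I q N ≡ true × N ≢ L × N ≢ M)
    R₅-inv h =
      let p≢q , common = ∧-true (p =/= q) h
          N , N-common = anyFin⇒∃ _ common
          pN , qN , N≢L , N≢M = ∧₄-true (I p N) (I q N) (N =/= L) N-common
      in =/=⇒≢ p≢q , N , pN , qN , =/=⇒≢ N≢L , =/=⇒≢ N≢M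

    R₆-inv : F (# 6) p L q M ≡ true →
             L ≢ M × ∃[ r ] (I r L ≡ true × I r M ≡ true × r ≢ p × r ≢ q)
    R₆-inv h =
      let L≢M , meet = ∧-true (L =/= M) h
          r , r-meet = anyFin⇒∃ _ meet
          rL , rM , r≢p , r≢q = ∧₄-true (I r L) (I r M) (r =/= p) r-meet
      in =/=⇒≢ L≢M , r , rL , rM , =/=⇒≢ r≢p , =/=⇒≢ r≢q

    R₇-inv : F (# 7) p L q M ≡ true →
             (∀ r → I r L ≡ true → I r M ≢ true) × (∀ N → I p N ≡ true → I q N ≢ true)
    R₇-inv h =
      let disjoint , noncollinear = ∧-true (not (anyFin (λ r → I r L ∧ I r M))) h
      in (λ r rL rM → not-anyFin _ r disjoint (∧-intro rL rM)) ,
         (λ N pN qN → not-anyFin _ N noncollinear (∧-intro pN qN))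

  PointClass⇒samePoint : ∀ {i} p L q M → PointClass i → F i p L q M ≡ true → p ≡ q
  PointClass⇒samePoint p L q M (inj₁ refl) = proj₁ ∘ R₀-inv p L q M
  PointClass⇒samePoint p L q M (inj₂ refl) = proj₁ ∘ R₁-inv p L q M

  LineClass⇒sameLine : ∀ {i} p L q M → LineClass i → F i p L q M ≡ true → L ≡ M
  LineClass⇒sameLine p L q M (inj₁ refl) = proj₂ ∘ R₀-inv p L q M
  LineClass⇒sameLine p L q M (inj₂ refl) = proj₁ ∘ R₂-inv p L q M

  samePoint⇒PointClass : ∀ j q N M → I q N ≡ true → I q M ≡ true →
                         F j q N q M ≡ true → PointClass j
  samePoint⇒PointClass fz q N M _ _ _ = inj₁ refl
  samePoint⇒PointClass (fs fz) q N M _ _ _ = inj₂ refl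
  samePoint⇒PointClass (fs (fs fz)) q N M _ _ h =
    contradiction refl (proj₂ (R₂-inv q N q M h))
  samePoint⇒PointClass (fs (fs (fs fz))) q N M _ _ h =
    contradiction refl (proj₁ (R₃-inv q N q M h))
  samePoint⇒PointClass (fs (fs (fs (fs fz)))) q N M _ _ h =
    contradiction refl (proj₁ (R₄-inv q N q M h))
  samePoint⇒PointClass (fs (fs (fs (fs (fs fz))))) q N M _ _ h =
    contradiction refl (proj₁ (R₅-inv q N q M h))
  samePoint⇒PointClass (fs (fs (fs (fs (fs (fs fz)))))) q N M qN qM h =
    let N≢M , r , rN , rM , r≢q , _ = R₆-inv q N q M h
    in contradiction (linesOnePoint N M r q N≢M rN rM qN qM) r≢q
  samePoint⇒PointClass (fs (fs (fs (fs (fs (fs (fs fz))))))) q N M qN qM h =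
    contradiction qN (proj₂ (R₇-inv q N q M h) N qN)

  sameLine⇒LineClass : ∀ j r q N → I r N ≡ true → I q N ≡ true →
                       F j r N q N ≡ true → LineClass j
  sameLine⇒LineClass fz r q N _ _ _ = inj₁ refl
  sameLine⇒LineClass (fs fz) r q N _ _ h =
    contradiction refl (proj₂ (R₁-inv r N q N h))
  sameLine⇒LineClass (fs (fs fz)) r q N _ _ _ = inj₂ refl
  sameLine⇒LineClass (fs (fs (fs fz))) r q N _ _ h =
    contradiction refl (proj₂ (proj₂ (proj₂ (R₃-inv r N q N h))))
  sameLine⇒LineClass (fs (fs (fs (fs fz)))) r q N _ _ h =
    contradiction refl (proj₂ (proj₂ (proj₂ (R₄-inv r N q N h))))
  sameLine⇒LineClass (fs (fs (fs (fs (fs fz))))) r q N rN qN h =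
    let r≢q , N' , rN' , qN' , N'≢N , _ = R₅-inv r N q N h
    in contradiction (pointsOneLine r q N' N r≢q rN' qN' rN qN) N'≢N
  sameLine⇒LineClass (fs (fs (fs (fs (fs (fs fz)))))) r q N _ _ h =
    contradiction refl (proj₁ (R₆-inv r N q N h))
  sameLine⇒LineClass (fs (fs (fs (fs (fs (fs (fs fz))))))) r q N rN _ h =
    contradiction rN (proj₁ (R₇-inv r N q N h) r rN)

  foot-unique : ∀ p M L N w q → I p M ≡ false →
                I p L ≡ true → I w L ≡ true → I w M ≡ true →
                I p N ≡ true → I q N ≡ true → I q M ≡ true → w ≡ q
  foot-unique p M L N w q pM pL wL wM pN qN qM =
    let _ , _ , unique = gqAxiom p M pM
    in trans (proj₁ (unique w L pL wL wM)) (sym (proj₁ (unique q N pN qN qM)))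

  -- A witness of p^k_{ij} ≠ 0, for the flags f = (p,L), g = (q,M), h = (r,N).
  data Triangle (i j k : Fin 8) : Set where
    triangle : ∀ p L q M r N → I p L ≡ true → I q M ≡ true → I r N ≡ true →
               F k p L q M ≡ true → F i p L r N ≡ true → F j r N q M ≡ true →
               Triangle i j k

  flagCount≢0⇒Triangle : ∀ {i j k} p L q M → I p L ≡ true → I q M ≡ true →
                         F k p L q M ≡ true → flagCount I i j p L q M ≢ 0 →
                         Triangle i j k
  flagCount≢0⇒Triangle {i} p L q M pL qM fk count≢0
    with r , r-count≢0 ← sumFin≢0⇒∃ _ count≢0
    with N , rN∧fi∧fj ← countFin≢0⇒∃ _ r-count≢0
    = let rN , fi∧fj = ∧-true (I r N) rN∧fi∧fj
          fi , fj = ∧-true (F i p L r N) fi∧fj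
      in triangle p L q M r N pL qM rN fk fi fj

  Triangle-PointClass : ∀ {i j k} → Triangle i j k → PointClass i → PointClass k → PointClass j
  Triangle-PointClass (triangle p L q M r N _ qM rN fk fi fj) i-pt k-pt
    with refl ← PointClass⇒samePoint p L r N i-pt fi
    with refl ← PointClass⇒samePoint p L q M k-pt fk
    = samePoint⇒PointClass _ p N M rN qM fj

  Triangle-LineClass : ∀ {i j k} → Triangle i j k → LineClass i → LineClass k → LineClass j
  Triangle-LineClass (triangle p L q M r N _ qM rN fk fi fj) i-ln k-ln
    with refl ← LineClass⇒sameLine p L r N i-ln fi
    with refl ← LineClass⇒sameLine p L q M k-ln fk
    = sameLine⇒LineClass _ r q L rN qM fj

  ¬Triangle₃₂₃ : ¬ Triangle (# 3) (# 2) (# 3)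
  ¬Triangle₃₂₃ (triangle p L q M r N _ qM rN fk fi fj) =
    let _ , _ , qL , M≢L = R₃-inv p L q M fk
        _ , _ , rL , _ = R₃-inv p L r N fi
        N≡M , r≢q = R₂-inv r N q M fj
    in r≢q (linesOnePoint L M r q (M≢L ∘ sym) rL (subst (λ K → I r K ≡ true) N≡M rN) qL qM)

  ¬Triangle₁₃₃ : ¬ Triangle (# 1) (# 3) (# 3)
  ¬Triangle₁₃₃ (triangle p L q M r N _ _ _ fk fi fj)
    with refl , L≢N ← R₁-inv p L r N fi =
    let p≢q , pL , qL , _ = R₃-inv p L q M fk
        _ , pN , qN , _ = R₃-inv p N q M fj
    in L≢N (pointsOneLine p q L N p≢q pL qL pN qN)

  ¬Triangle₁₃₆ : ¬ Triangle (# 1) (# 3) (# 6)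
  ¬Triangle₁₃₆ (triangle p L q M r N pL qM _ fk fi fj)
    with refl , _ ← R₁-inv p L r N fi
    with p≢q , pN , qN , M≢N ← R₃-inv p N q M fj
    with _ , w , wL , wM , _ , w≢q ← R₆-inv p L q M fk
    with I p M in pM
  ... | true  = M≢N (sym (pointsOneLine p q N M p≢q pN qN pM qM))
  ... | false = w≢q (foot-unique p M L N w q pM pL wL wM pN qN qM)

  Triangle₃₂⇒6 : ∀ {k} → Triangle (# 3) (# 2) k → k ≡ # 6
  Triangle₃₂⇒6 {k} (triangle p L q M r N pL qM rN fk fi fj)
    with p≢r , _ , rL , N≢L ← R₃-inv p L r N fi
    with refl , r≢q ← R₂-inv r N q M fj
    = exclude k fk
    where
    p∉N : I p N ≢ true
    p∉N pN = N≢L (pointsOneLine p r N L p≢r pN rN pL rL)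

    exclude : ∀ k → F k p L q N ≡ true → k ≡ # 6
    exclude fz h = contradiction (proj₂ (R₀-inv p L q N h)) (N≢L ∘ sym)
    exclude (fs fz) h with refl , _ ← R₁-inv p L q N h = contradiction qM p∉N
    exclude (fs (fs fz)) h = contradiction (proj₁ (R₂-inv p L q N h)) (N≢L ∘ sym)
    exclude (fs (fs (fs fz))) h =
      let _ , _ , qL , _ = R₃-inv p L q N h
      in contradiction (linesOnePoint L N r q (N≢L ∘ sym) rL rN qL qM) r≢q
    exclude (fs (fs (fs (fs fz)))) h = contradiction (proj₁ (proj₂ (R₄-inv p L q N h))) p∉N
    exclude (fs (fs (fs (fs (fs fz))))) h with I p N in pN
    ... | true  = contradiction pN p∉N
    ... | false =
      let _ , N' , pN' , qN' , _ = R₅-inv p L q N h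
      in contradiction (foot-unique p N L N' r q pN pL rL rN pN' qN' qM) r≢q
    exclude (fs (fs (fs (fs (fs (fs fz)))))) h = refl
    exclude (fs (fs (fs (fs (fs (fs (fs fz))))))) h =
      contradiction rN (proj₁ (R₇-inv p L q N h) r rL)

module FlagSchemeTransfer
  {np nl n s t : ℕ} {I : Fin np → Fin nl → Bool} {R : Fin n → Fin n → Fin 8} {φ : Fin 8 ↔ Fin 8}
  (gq : IsGQ s t I) (flagsNonempty : FlagClassesNonempty I)
  (scheme : IsAssocScheme R) (alg : AlgIso I R φ) where
  open Inverse φ using (to; from; strictlyInverseˡ)
  open IsAssocScheme scheme
  open QuadrangleFlags gq

  R≡φ∘φ⁻¹ : ∀ x y → R x y ≡ to (from (R x y))
  R≡φ∘φ⁻¹ x y = sym (strictlyInverseˡ (R x y))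

  flagTriangle : ∀ {i j k} x y z → R x y ≡ to k → R x z ≡ to i → R z y ≡ to j → Triangle i j k
  flagTriangle {i} {j} {k} x y z Rxy Rxz Rzy
    with (p , L , q , M) , pL , qM , fk ← flagsNonempty k
    = flagCount≢0⇒Triangle p L q M pL qM fk
        (subst (_≢ 0) (alg i j k p L q M pL qM fk x y Rxy) schemeCount≢0)
    where
    schemeCount≢0 : schemeCount R (to i) (to j) x y ≢ 0
    schemeCount≢0 = ∃⇒countFin≢0 _ z (∧-intro (≡⇒== Rxz) (≡⇒== Rzy))

  φ₀≡0 : to (# 0) ≡ # 0
  φ₀≡0 with x , y , Rxy ← nonempty (to (# 0)) =
    begin
      to (# 0)          ≡⟨ cong to (sym j≡0) ⟩
      to (from (# 0))   ≡⟨ strictlyInverseˡ (# 0) ⟩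
      # 0               ∎
    where
    open ≡-Reasoning
    loop : Triangle (# 0) (from (# 0)) (# 0)
    loop = flagTriangle x y y Rxy Rxy (trans (diag₂ y) (sym (strictlyInverseˡ (# 0))))
    j≡0 : from (# 0) ≡ # 0
    j≡0 = PointClass∩LineClass⇒0 (Triangle-PointClass loop (inj₁ refl) (inj₁ refl))
                                 (Triangle-LineClass loop (inj₁ refl) (inj₁ refl))

  φ₀⇒≡ : ∀ {x y} → R x y ≡ to (# 0) → x ≡ y
  φ₀⇒≡ Rxy = diag₁ _ _ (trans Rxy φ₀≡0)

  pointClass : ∀ {a x} → InPointClique R φ a x → Σ[ i ∈ Fin 8 ] (R a x ≡ to i × PointClass i)
  pointClass (inj₁ Rax) = # 0 , Rax , inj₁ refl
  pointClass (inj₂ Rax) = # 1 , Rax , inj₂ refl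

  lineClass : ∀ {a x} → InLineClique R φ a x → Σ[ i ∈ Fin 8 ] (R a x ≡ to i × LineClass i)
  lineClass (inj₁ Rax) = # 0 , Rax , inj₁ refl
  lineClass (inj₂ Rax) = # 2 , Rax , inj₂ refl

  pointClique-trans : ∀ {a x x'} → InPointClique R φ a x → InPointClique R φ a x' →
                      InPointClique R φ x x'
  pointClique-trans {a} {x} {x'} ax ax'
    with _ , Rax , i-pt ← pointClass ax
    with _ , Rax' , k-pt ← pointClass ax'
    with Triangle-PointClass (flagTriangle a x' x Rax' Rax (R≡φ∘φ⁻¹ x x')) i-pt k-pt
  ... | inj₁ j≡0 = inj₁ (trans (R≡φ∘φ⁻¹ x x') (cong to j≡0))
  ... | inj₂ j≡1 = inj₂ (trans (R≡φ∘φ⁻¹ x x') (cong to j≡1))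

  lineClique-trans : ∀ {b y y'} → InLineClique R φ b y → InLineClique R φ b y' →
                     InLineClique R φ y y'
  lineClique-trans {b} {y} {y'} by by'
    with _ , Rby , i-ln ← lineClass by
    with _ , Rby' , k-ln ← lineClass by'
    with Triangle-LineClass (flagTriangle b y' y Rby' Rby (R≡φ∘φ⁻¹ y y')) i-ln k-ln
  ... | inj₁ j≡0 = inj₁ (trans (R≡φ∘φ⁻¹ y y') (cong to j≡0))
  ... | inj₂ j≡2 = inj₂ (trans (R≡φ∘φ⁻¹ y y') (cong to j≡2))

  φ₃∘φ₂⊆φ₆ : ∀ {x y z} → R x z ≡ to (# 3) → R z y ≡ to (# 2) → R x y ≡ to (# 6)
  φ₃∘φ₂⊆φ₆ {x} {y} {z} Rxz Rzy =
    trans (R≡φ∘φ⁻¹ x y) (cong to (Triangle₃₂⇒6 (flagTriangle x y z (R≡φ∘φ⁻¹ x y) Rxz Rzy)))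

mainTheorem7 : ∀ {np nl n : ℕ} (s t : ℕ) (I : Fin np → Fin nl → Bool) →
    IsGQ s t I → FlagClassesNonempty I →
    (R : Fin n → Fin n → Fin 8) → IsAssocScheme R →
    (φ : Fin 8 ↔ Fin 8) → AlgIso I R φ →
    ∀ (a b : Fin n) →
    ¬ (∃[ z ] (InPointClique R φ a z × InLineClique R φ b z)) →
    ∀ (x y x' y' : Fin n) →
    InPointClique R φ a x → InLineClique R φ b y → R x y ≡ Inverse.to φ (# 3) →
    InPointClique R φ a x' → InLineClique R φ b y' → R x' y' ≡ Inverse.to φ (# 3) →
    x ≡ x' × y ≡ y'
mainTheorem7 s t I gq flagsNonempty R scheme φ alg a b _ x y x' y' ax by Rxy ax' by' Rx'y' =
  cases (pointClique-trans ax ax') (lineClique-trans by by')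
  where
  open FlagSchemeTransfer {φ = φ} gq flagsNonempty scheme alg
  open QuadrangleFlags gq

  cases : InPointClique R φ x x' → InLineClique R φ y y' → x ≡ x' × y ≡ y'
  cases (inj₁ x≈x') (inj₁ y≈y') = φ₀⇒≡ x≈x' , φ₀⇒≡ y≈y'
  cases (inj₁ x≈x') (inj₂ y~y') with refl ← φ₀⇒≡ x≈x' =
    ⊥-elim (¬Triangle₃₂₃ (flagTriangle x y' y Rx'y' Rxy y~y'))
  cases (inj₂ x~x') (inj₁ y≈y') with refl ← φ₀⇒≡ y≈y' =
    ⊥-elim (¬Triangle₁₃₃ (flagTriangle x y x' Rxy x~x' Rx'y'))
  cases (inj₂ x~x') (inj₂ y~y') =
    ⊥-elim (¬Triangle₁₃₆ (flagTriangle x y' x' (φ₃∘φ₂⊆φ₆ Rxy y~y') x~x' Rx'y'))
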